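{- Let $R$ be a non-terminating HRS. Then there exists a term $t$ of basic type such that $t$ is not strongly computable in $R$ but every argument of $t$ is strongly computable in $R$; i.e. $\mathcal{T}_{\mathcal{B}}\cap\mathcal{T}_{\neg SC}(R)\cap\mathcal{T}^{\mathit{args}}_{SC}(R)\neq\emptyset$.
   Context: Simple types are generated from basic types $\mathcal{B}$ by $\to$. Terms are simply-typed $\lambda$-terms over disjoint sets of typed variables and function symbols $\Sigma$, in $\eta$-long $\beta$-normal form; $t{\downarrow}$ denotes the $\eta$-long $\beta$-normal form; terms are up to $\alpha$-equivalence. Every term has the form $\lambda x_1\cdots x_m.\,a(t_1,\ldots,t_n)$ with $a$ a variable or function symbol; $\mathit{args}(t)=\{t_1,\ldots,t_n\}$. A rewrite rule $l\to r$ has $l$'s top symbol in $\Sigma$, $type(l)=type(r)\in\mathcal{B}$, and free variables of $r$ among those of $l$; an HRS is a set of rules; $s\to_R t$ iff $s\equiv C[l\theta{\downarrow}]$, $t\equiv C[r\theta{\downarrow}]$ for some rule, context $C$, substitution $\theta$. $R$ is terminating if there is no infinite $\to_R$-sequence; $SN(R,t)$: none from $t$. $SC(R,t)$: for basic-typed $t$, $SN(R,t)$; for $type(t)=\alpha\to\beta$, $SC(R,(t\,u){\downarrow})$ for all $u$ of type $\alpha$ with $SC(R,u)$. $\mathcal{T}_{\mathcal{B}}$ is the set of terms of basic type, $\mathcal{T}_{\neg SC}(R)$ the set of terms $t$ with $\neg SC(R,t)$, and $\mathcal{T}^{\mathit{args}}_{SC}(R)=\{t\mid\forall u\in\mathit{args}(t).\,SC(R,u)\}$.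 -}

module Defs where

open import Data.Nat using (ℕ; zero; suc)
open import Data.List using (List; []; _∷_)
open import Data.Product using (Σ; _×_; _,_)
open import Relation.Binary.PropositionalEquality using (_≡_)
open import Relation.Nullary using (¬_)
open import Data.Unit using (⊤)

data Ty (B : Set) : Set where
  base : B → Ty B
  _⇒_  : Ty B → Ty B → Ty B

infixr 5 _⇒_

-- Terms: locally nameless, intrinsically simply typed, in eta-long beta-normal
-- form.  Bound variables are de Bruijn indices into a context Γ; free variables
-- are names: for each type A there are countably many variables (A , n), n : ℕ.
-- "Terms" of the paper are the terms with empty bound context: Tm A = Nf [] A.
module HRS (B : Set) (F : Set) (tyF : F → Ty B) where

  Ctx : Set
  Ctx = List (Ty B)

  data _∈_ : Ty B → Ctx → Set where
    here  : ∀ {A Γ} → A ∈ (A ∷ Γ)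
    there : ∀ {A C Γ} → A ∈ Γ → A ∈ (C ∷ Γ)

  data Head (Γ : Ctx) : Ty B → Set where
    bv : ∀ {A} → A ∈ Γ → Head Γ A
    fv : (A : Ty B) → ℕ → Head Γ A
    fs : (f : F) → Head Γ (tyF f)

  -- eta-long beta-normal terms: λ x1..xm. a(t1,..,tn), a applied to all its
  -- arguments (Sp Γ A b : list of arguments taking type A down to basic b)
  mutual
    data Nf (Γ : Ctx) : Ty B → Set where
      lam : ∀ {A C} → Nf (A ∷ Γ) C → Nf Γ (A ⇒ C)
      ne  : ∀ {A b} → Head Γ A → Sp Γ A b → Nf Γ (base b)

    data Sp (Γ : Ctx) : Ty B → B → Set where
      []  : ∀ {b} → Sp Γ (base b) b
      _∷_ : ∀ {A C b} → Nf Γ A → Sp Γ C b → Sp Γ (A ⇒ C) b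

  Tm : Ty B → Set
  Tm A = Nf [] A

  Ren : Ctx → Ctx → Set
  Ren Γ Δ = ∀ {A} → A ∈ Γ → A ∈ Δ

  liftR : ∀ {Γ Δ C} → Ren Γ Δ → Ren (C ∷ Γ) (C ∷ Δ)
  liftR ρ here      = here
  liftR ρ (there x) = there (ρ x)

  mutual
    ren : ∀ {Γ Δ A} → Ren Γ Δ → Nf Γ A → Nf Δ A
    ren ρ (lam t)         = lam (ren (liftR ρ) t)
    ren ρ (ne (bv x) sp)  = ne (bv (ρ x)) (renSp ρ sp)
    ren ρ (ne (fv A n) sp) = ne (fv A n) (renSp ρ sp)
    ren ρ (ne (fs f) sp)  = ne (fs f) (renSp ρ sp)

    renSp : ∀ {Γ Δ A b} → Ren Γ Δ → Sp Γ A b → Sp Δ A b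
    renSp ρ []       = []
    renSp ρ (t ∷ sp) = ren ρ t ∷ renSp ρ sp

  wk : ∀ {Γ A C} → Nf Γ A → Nf (C ∷ Γ) A
  wk = ren there

  wk0 : ∀ {Γ A} → Nf [] A → Nf Γ A
  wk0 = ren (λ ())

  -- hereditary substitution of a bound variable (this computes (t u)↓)
  _-_ : (Γ : Ctx) → ∀ {A} → A ∈ Γ → Ctx
  (A ∷ Γ) - here    = Γ
  (C ∷ Γ) - there x = C ∷ (Γ - x)

  wkv : ∀ {Γ A C} (x : A ∈ Γ) → C ∈ (Γ - x) → C ∈ Γ
  wkv here      y         = there y
  wkv (there x) here      = here
  wkv (there x) (there y) = there (wkv x y)

  data EqV {Γ A} (x : A ∈ Γ) : ∀ {C} → C ∈ Γ → Set where
    same : EqV x x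
    diff : ∀ {C} (y : C ∈ (Γ - x)) → EqV x (wkv x y)

  eqv : ∀ {Γ A C} (x : A ∈ Γ) (y : C ∈ Γ) → EqV x y
  eqv here      here      = same
  eqv here      (there y) = diff y
  eqv (there x) here      = diff here
  eqv (there x) (there y) with eqv x y
  ... | same   = same
  ... | diff z = diff (there z)

  mutual
    substNf : ∀ {Γ A C} → Nf Γ C → (x : A ∈ Γ) → Nf (Γ - x) A → Nf (Γ - x) C
    substNf (lam t) x u = lam (substNf t (there x) (wk u))
    substNf (ne (bv y) sp) x u with eqv x y
    ... | same   = appSp u (substSp sp x u)
    ... | diff z = ne (bv z) (substSp sp x u)
    substNf (ne (fv A n) sp) x u = ne (fv A n) (substSp sp x u)
    substNf (ne (fs f) sp) x u = ne (fs f) (substSp sp x u)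

    substSp : ∀ {Γ A C b} → Sp Γ C b → (x : A ∈ Γ) → Nf (Γ - x) A → Sp (Γ - x) C b
    substSp []        x u = []
    substSp (t ∷ sp)  x u = substNf t x u ∷ substSp sp x u

    appSp : ∀ {Γ A b} → Nf Γ A → Sp Γ A b → Nf Γ (base b)
    appSp t        []       = t
    appSp (lam t)  (u ∷ sp) = appSp (substNf t here u) sp

  napp : ∀ {Γ A C} → Nf Γ (A ⇒ C) → Nf Γ A → Nf Γ C
  napp (lam t) u = substNf t here u

  FSub : Ctx → Set
  FSub Γ = (A : Ty B) → ℕ → Nf Γ A

  mutual
    inst : ∀ {Γ A} → FSub Γ → Nf Γ A → Nf Γ A
    inst θ (lam t)          = lam (inst (λ A n → wk (θ A n)) t)
    inst θ (ne (bv x) sp)   = ne (bv x) (instSp θ sp)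
    inst θ (ne (fv A n) sp) = appSp (θ A n) (instSp θ sp)
    inst θ (ne (fs f) sp)   = ne (fs f) (instSp θ sp)

    instSp : ∀ {Γ A b} → FSub Γ → Sp Γ A b → Sp Γ A b
    instSp θ []       = []
    instSp θ (t ∷ sp) = inst θ t ∷ instSp θ sp

  mutual
    data Occ (A : Ty B) (n : ℕ) {Γ : Ctx} : ∀ {C} → Nf Γ C → Set where
      occ-lam  : ∀ {D C} {t : Nf (D ∷ Γ) C} → Occ A n t → Occ A n (lam t)
      occ-head : ∀ {b} {sp : Sp Γ A b} → Occ A n (ne (fv A n) sp)
      occ-arg  : ∀ {C b} {h : Head Γ C} {sp : Sp Γ C b} → OccSp A n sp → Occ A n (ne h sp)

    data OccSp (A : Ty B) (n : ℕ) {Γ : Ctx} : ∀ {C b} → Sp Γ C b → Set where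
      occ-here  : ∀ {D C b} {t : Nf Γ D} {sp : Sp Γ C b} → Occ A n t → OccSp A n (t ∷ sp)
      occ-there : ∀ {D C b} {t : Nf Γ D} {sp : Sp Γ C b} → OccSp A n sp → OccSp A n (t ∷ sp)

  record Rule : Set where
    field
      ty    : B
      sym   : F
      largs : Sp [] (tyF sym) ty
      rhs   : Tm (base ty)
      fvOK  : ∀ A n → Occ A n rhs → Occ A n (ne (fs sym) largs)

    lhs : Tm (base ty)
    lhs = ne (fs sym) largs

  HRSys : Set₁
  HRSys = Rule → Set

  -- s →R t  iff  s ≡ C[lθ↓], t ≡ C[rθ↓]  (the context may bind variables
  -- occurring in the image of θ)
  module _ (R : HRSys) where
    mutual
      data Step {Γ : Ctx} : ∀ {A} → Nf Γ A → Nf Γ A → Set where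
        root : (ρ : Rule) → R ρ → (θ : FSub Γ) →
               Step (inst θ (wk0 (Rule.lhs ρ))) (inst θ (wk0 (Rule.rhs ρ)))
        lamS : ∀ {D C} {t t' : Nf (D ∷ Γ) C} → Step t t' → Step (lam t) (lam t')
        argS : ∀ {C b} {h : Head Γ C} {sp sp' : Sp Γ C b} →
               StepSp sp sp' → Step (ne h sp) (ne h sp')

      data StepSp {Γ : Ctx} : ∀ {C b} → Sp Γ C b → Sp Γ C b → Set where
        hereS  : ∀ {D C b} {t t' : Nf Γ D} {sp : Sp Γ C b} →
                 Step t t' → StepSp (t ∷ sp) (t' ∷ sp)
        thereS : ∀ {D C b} {t : Nf Γ D} {sp sp' : Sp Γ C b} →
                 StepSp sp sp' → StepSp (t ∷ sp) (t ∷ sp')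

    InfSeqFrom : ∀ {A} → Tm A → Set
    InfSeqFrom {A} t = Σ (ℕ → Tm A) λ f → (f 0 ≡ t) × (∀ i → Step (f i) (f (suc i)))

    SN : ∀ {A} → Tm A → Set
    SN t = ¬ InfSeqFrom t

    Terminating : Set
    Terminating = ¬ (Σ (Ty B) λ A → Σ (Tm A) λ t → InfSeqFrom t)

    NonTerminating : Set
    NonTerminating = ¬ Terminating

    SC : (A : Ty B) → Tm A → Set
    SC (base b) t = SN t
    SC (A ⇒ C)  t = ∀ (u : Tm A) → SC A u → SC C (napp t u)

    AllSpSC : ∀ {C b} → Sp [] C b → Set
    AllSpSC []            = ⊤
    AllSpSC (_∷_ {A} u sp) = SC A u × AllSpSC sp

    ArgsSC : ∀ {b} → Tm (base b) → Set
    ArgsSC (ne h sp) = AllSpSC sp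

{-# OPTIONS --safe #-}
module Submission where

-- Suppose, towards a contradiction, that every basic term whose arguments are
-- strongly computable is itself strongly computable (i.e. terminating).  Then
-- Tait's argument goes through: by induction on open terms, every term becomes
-- strongly computable once its bound variables are closed by strongly
-- computable terms, so every closed term is strongly computable.  But if t
-- starts an infinite reduction, then x(t), for a free variable x, has the
-- strongly computable argument t and still starts an infinite reduction.  The
-- substance of the proof is the substitution lemma for hereditary
-- substitution, needed in the λ-case of the induction.

open import Defs
open import Data.Product using (_×_; _,_; proj₁; proj₂)
open import Data.List using ([]; _∷_)
open import Data.Sum using (_⊎_; inj₁; inj₂)
open import Data.Unit using (⊤; tt)
open import Relation.Nullary using (¬_)
open import Relation.Binary.PropositionalEquality
  using (_≡_; refl; sym; trans; cong; cong₂; subst; module ≡-Reasoning)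

module Metatheory (B F : Set) (tyF : F → Ty B) where
  open HRS B F tyF
  open ≡-Reasoning

  variable
    Γ Γ' Δ Δ' Θ : Ctx
    A C D E : Ty B
    b : B
    Γ₁ Γ₁₂ Γ₂ : Ctx

  -- Del A Γ Γ' : Γ' is Γ with one variable of type A removed.  Unlike Γ - x,
  -- the smaller context is an index, so it unifies when two removals commute.
  data Del (A : Ty B) : Ctx → Ctx → Set where
    dhere  : Del A (A ∷ Γ) Γ
    dthere : Del A Γ Γ' → Del A (C ∷ Γ) (C ∷ Γ')

  deletedVar : Del A Γ Γ' → A ∈ Γ
  deletedVar dhere      = here
  deletedVar (dthere d) = there (deletedVar d)

  keptVar : Del A Γ Γ' → Ren Γ' Γ
  keptVar dhere      y         = there y
  keptVar (dthere d) here      = here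
  keptVar (dthere d) (there y) = there (keptVar d y)

  data Compare (d : Del A Γ Γ') : C ∈ Γ → Set where
    is-deleted : Compare d (deletedVar d)
    is-kept    : (z : C ∈ Γ') → Compare d (keptVar d z)

  compare-there : {d : Del A Γ Γ'} {y : C ∈ Γ} → Compare d y →
                  Compare (dthere {C = E} d) (there y)
  compare-there is-deleted  = is-deleted
  compare-there (is-kept z) = is-kept (there z)

  compare : (d : Del A Γ Γ') (y : C ∈ Γ) → Compare d y
  compare dhere      here      = is-deleted
  compare dhere      (there y) = is-kept y
  compare (dthere d) here      = is-kept here
  compare (dthere d) (there y) = compare-there (compare d y)

  compare-deletedVar : (d : Del A Γ Γ') → compare d (deletedVar d) ≡ is-deleted
  compare-deletedVar dhere = refl
  compare-deletedVar (dthere d) rewrite compare-deletedVar d = refl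

  compare-keptVar : (d : Del A Γ Γ') (z : C ∈ Γ') → compare d (keptVar d z) ≡ is-kept z
  compare-keptVar dhere      z         = refl
  compare-keptVar (dthere d) here      = refl
  compare-keptVar (dthere d) (there z) rewrite compare-keptVar d z = refl

  mutual
    sub : Del A Γ Γ' → Nf Γ C → Nf Γ' A → Nf Γ' C
    sub d (lam t)          u = lam (sub (dthere d) t (wk u))
    sub d (ne (bv y) sp)   u = subVar d (compare d y) u (subSp d sp u)
    sub d (ne (fv A n) sp) u = ne (fv A n) (subSp d sp u)
    sub d (ne (fs f) sp)   u = ne (fs f) (subSp d sp u)

    subSp : Del A Γ Γ' → Sp Γ C b → Nf Γ' A → Sp Γ' C b
    subSp d []       u = []
    subSp d (t ∷ sp) u = sub d t u ∷ subSp d sp u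

    subVar : (d : Del A Γ Γ') {y : C ∈ Γ} → Compare d y → Nf Γ' A → Sp Γ' C b → Nf Γ' (base b)
    subVar d is-deleted  u sp = apply u sp
    subVar d (is-kept z) u sp = ne (bv z) sp

    apply : Nf Γ A → Sp Γ A b → Nf Γ (base b)
    apply t       []       = t
    apply (lam t) (u ∷ sp) = apply (sub dhere t u) sp

  sub-deletedVar : (d : Del A Γ Γ') (sp : Sp Γ A b) (u : Nf Γ' A) →
                   sub d (ne (bv (deletedVar d)) sp) u ≡ apply u (subSp d sp u)
  sub-deletedVar d sp u rewrite compare-deletedVar d = refl

  sub-keptVar : (d : Del A Γ Γ') (z : C ∈ Γ') (sp : Sp Γ C b) (u : Nf Γ' A) →
                sub d (ne (bv (keptVar d z)) sp) u ≡ ne (bv z) (subSp d sp u)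
  sub-keptVar d z sp u rewrite compare-keptVar d z = refl

  toDel : (x : A ∈ Γ) → Del A Γ (Γ - x)
  toDel here      = dhere
  toDel (there x) = dthere (toDel x)

  deletedVar-toDel : (x : A ∈ Γ) → deletedVar (toDel x) ≡ x
  deletedVar-toDel here      = refl
  deletedVar-toDel (there x) = cong there (deletedVar-toDel x)

  keptVar-toDel : (x : A ∈ Γ) (z : C ∈ (Γ - x)) → keptVar (toDel x) z ≡ wkv x z
  keptVar-toDel here      z         = refl
  keptVar-toDel (there x) here      = refl
  keptVar-toDel (there x) (there z) = cong there (keptVar-toDel x z)

  mutual
    substNf≡sub : (t : Nf Γ C) (x : A ∈ Γ) (u : Nf (Γ - x) A) → substNf t x u ≡ sub (toDel x) t u
    substNf≡sub (lam t) x u = cong lam (substNf≡sub t (there x) (wk u))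
    substNf≡sub (ne (bv y) sp) x u with eqv x y
    ... | same = begin
      appSp u (substSp sp x u)                  ≡⟨ appSp≡apply u (substSp sp x u) ⟩
      apply u (substSp sp x u)                  ≡⟨ cong (apply u) (substSp≡subSp sp x u) ⟩
      apply u (subSp (toDel x) sp u)            ≡⟨ sym (sub-deletedVar (toDel x) sp u) ⟩
      sub (toDel x) (ne (bv (deletedVar (toDel x))) sp) u
        ≡⟨ cong (λ y → sub (toDel x) (ne (bv y) sp) u) (deletedVar-toDel x) ⟩
      sub (toDel x) (ne (bv x) sp) u            ∎
    ... | diff z = begin
      ne (bv z) (substSp sp x u)                ≡⟨ cong (ne (bv z)) (substSp≡subSp sp x u) ⟩
      ne (bv z) (subSp (toDel x) sp u)          ≡⟨ sym (sub-keptVar (toDel x) z sp u) ⟩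
      sub (toDel x) (ne (bv (keptVar (toDel x) z)) sp) u
        ≡⟨ cong (λ y → sub (toDel x) (ne (bv y) sp) u) (keptVar-toDel x z) ⟩
      sub (toDel x) (ne (bv (wkv x z)) sp) u    ∎
    substNf≡sub (ne (fv A n) sp) x u = cong (ne (fv A n)) (substSp≡subSp sp x u)
    substNf≡sub (ne (fs f) sp)   x u = cong (ne (fs f)) (substSp≡subSp sp x u)

    substSp≡subSp : (sp : Sp Γ C b) (x : A ∈ Γ) (u : Nf (Γ - x) A) →
                    substSp sp x u ≡ subSp (toDel x) sp u
    substSp≡subSp []       x u = refl
    substSp≡subSp (t ∷ sp) x u = cong₂ _∷_ (substNf≡sub t x u) (substSp≡subSp sp x u)

    appSp≡apply : (t : Nf Γ A) (sp : Sp Γ A b) → appSp t sp ≡ apply t sp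
    appSp≡apply t       []       = refl
    appSp≡apply (lam t) (u ∷ sp) =
      trans (appSp≡apply (substNf t here u) sp) (cong (λ s → apply s sp) (substNf≡sub t here u))

  PointwiseEq : (ρ ρ' : Ren Γ Δ) → Set
  PointwiseEq {Γ = Γ} ρ ρ' = ∀ {C} (y : C ∈ Γ) → ρ y ≡ ρ' y

  liftR-cong : {ρ ρ' : Ren Γ Δ} → PointwiseEq ρ ρ' → PointwiseEq (liftR {C = E} ρ) (liftR ρ')
  liftR-cong e here      = refl
  liftR-cong e (there y) = cong there (e y)

  mutual
    ren-cong : {ρ ρ' : Ren Γ Δ} → PointwiseEq ρ ρ' → (t : Nf Γ C) → ren ρ t ≡ ren ρ' t
    ren-cong e (lam t)          = cong lam (ren-cong (liftR-cong e) t)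
    ren-cong e (ne (bv y) sp)   = cong₂ (λ z s → ne (bv z) s) (e y) (renSp-cong e sp)
    ren-cong e (ne (fv A n) sp) = cong (ne (fv A n)) (renSp-cong e sp)
    ren-cong e (ne (fs f) sp)   = cong (ne (fs f)) (renSp-cong e sp)

    renSp-cong : {ρ ρ' : Ren Γ Δ} → PointwiseEq ρ ρ' → (sp : Sp Γ C b) → renSp ρ sp ≡ renSp ρ' sp
    renSp-cong e []       = refl
    renSp-cong e (t ∷ sp) = cong₂ _∷_ (ren-cong e t) (renSp-cong e sp)

  liftR-∘ : (ρ : Ren Δ Θ) (σ : Ren Γ Δ) →
            PointwiseEq (λ y → liftR {C = E} ρ (liftR σ y)) (liftR (λ y → ρ (σ y)))
  liftR-∘ ρ σ here      = refl
  liftR-∘ ρ σ (there y) = refl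

  mutual
    ren-∘ : (ρ : Ren Δ Θ) (σ : Ren Γ Δ) (t : Nf Γ C) → ren ρ (ren σ t) ≡ ren (λ y → ρ (σ y)) t
    ren-∘ ρ σ (lam t) = cong lam (trans (ren-∘ (liftR ρ) (liftR σ) t) (ren-cong (liftR-∘ ρ σ) t))
    ren-∘ ρ σ (ne (bv y) sp)   = cong (ne (bv (ρ (σ y)))) (renSp-∘ ρ σ sp)
    ren-∘ ρ σ (ne (fv A n) sp) = cong (ne (fv A n)) (renSp-∘ ρ σ sp)
    ren-∘ ρ σ (ne (fs f) sp)   = cong (ne (fs f)) (renSp-∘ ρ σ sp)

    renSp-∘ : (ρ : Ren Δ Θ) (σ : Ren Γ Δ) (sp : Sp Γ C b) →
              renSp ρ (renSp σ sp) ≡ renSp (λ y → ρ (σ y)) sp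
    renSp-∘ ρ σ []       = refl
    renSp-∘ ρ σ (t ∷ sp) = cong₂ _∷_ (ren-∘ ρ σ t) (renSp-∘ ρ σ sp)

  liftR-id : PointwiseEq (liftR {Γ = Γ} {C = E} (λ y → y)) (λ y → y)
  liftR-id here      = refl
  liftR-id (there y) = refl

  mutual
    ren-id : (t : Nf Γ C) → ren (λ y → y) t ≡ t
    ren-id (lam t)          = cong lam (trans (ren-cong liftR-id t) (ren-id t))
    ren-id (ne (bv y) sp)   = cong (ne (bv y)) (renSp-id sp)
    ren-id (ne (fv A n) sp) = cong (ne (fv A n)) (renSp-id sp)
    ren-id (ne (fs f) sp)   = cong (ne (fs f)) (renSp-id sp)

    renSp-id : (sp : Sp Γ C b) → renSp (λ y → y) sp ≡ sp
    renSp-id []       = refl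
    renSp-id (t ∷ sp) = cong₂ _∷_ (ren-id t) (renSp-id sp)

  wk0-closed : (t : Tm C) → wk0 t ≡ t
  wk0-closed t = trans (ren-cong (λ ()) t) (ren-id t)

  wk-wk0 : (t : Tm C) → wk {C = E} (wk0 {Γ = Γ} t) ≡ wk0 t
  wk-wk0 t = trans (ren-∘ _ _ t) (ren-cong (λ ()) t)

  ren-wk : (ρ : Ren (E ∷ Γ) (E ∷ Δ)) (ρ' : Ren Γ Δ) → PointwiseEq (λ y → ρ (there y)) (λ y → there (ρ' y)) →
           (u : Nf Γ C) → ren ρ (wk u) ≡ wk (ren ρ' u)
  ren-wk ρ ρ' e u = trans (ren-∘ ρ there u) (trans (ren-cong e u) (sym (ren-∘ there ρ' u)))

  record RenDel (ρ : Ren Γ Δ) (ρ' : Ren Γ' Δ') (d : Del A Γ Γ') (d' : Del A Δ Δ') : Set where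
    field
      ren-deleted : ρ (deletedVar d) ≡ deletedVar d'
      ren-kept    : ∀ {C} (z : C ∈ Γ') → ρ (keptVar d z) ≡ keptVar d' (ρ' z)

  renDel-lift : {ρ : Ren Γ Δ} {ρ' : Ren Γ' Δ'} {d : Del A Γ Γ'} {d' : Del A Δ Δ'} →
                RenDel ρ ρ' d d' → RenDel (liftR {C = E} ρ) (liftR ρ') (dthere d) (dthere d')
  renDel-lift {E = E} c = record { ren-deleted = cong there (RenDel.ren-deleted c) ; ren-kept = kept }
    where
      kept : ∀ {C} (z : C ∈ (E ∷ _)) → _
      kept here      = refl
      kept (there z) = cong there (RenDel.ren-kept c z)

  renDel-wk : (d : Del A Γ Γ') → RenDel (there {C = D}) there d (dthere d)
  renDel-wk d = record { ren-deleted = refl ; ren-kept = λ z → refl }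

  renDel-here : (ρ : Ren Γ Δ) → RenDel (liftR {C = A} ρ) ρ dhere dhere
  renDel-here ρ = record { ren-deleted = refl ; ren-kept = λ z → refl }

  mutual
    ren-sub : {ρ : Ren Γ Δ} {ρ' : Ren Γ' Δ'} {d : Del A Γ Γ'} {d' : Del A Δ Δ'} →
              RenDel ρ ρ' d d' → (t : Nf Γ C) (u : Nf Γ' A) →
              ren ρ' (sub d t u) ≡ sub d' (ren ρ t) (ren ρ' u)
    ren-sub {ρ = ρ} {ρ'} {d' = d'} c (lam t) u =
      cong lam (trans (ren-sub (renDel-lift c) t (wk u))
                      (cong (sub (dthere d') (ren (liftR ρ) t)) (ren-wk (liftR ρ') ρ' (λ y → refl) u)))
    ren-sub {ρ = ρ} {ρ'} {d} {d'} c (ne (bv y) sp) u with compare d y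
    ... | is-deleted = begin
      ren ρ' (apply u (subSp d sp u))           ≡⟨ ren-apply ρ' u (subSp d sp u) ⟩
      apply (ren ρ' u) (renSp ρ' (subSp d sp u)) ≡⟨ cong (apply (ren ρ' u)) (renSp-subSp c sp u) ⟩
      apply (ren ρ' u) (subSp d' (renSp ρ sp) (ren ρ' u))
        ≡⟨ sym (sub-deletedVar d' (renSp ρ sp) (ren ρ' u)) ⟩
      sub d' (ne (bv (deletedVar d')) (renSp ρ sp)) (ren ρ' u)
        ≡⟨ cong (λ y → sub d' (ne (bv y) (renSp ρ sp)) (ren ρ' u)) (sym (RenDel.ren-deleted c)) ⟩
      sub d' (ne (bv (ρ (deletedVar d))) (renSp ρ sp)) (ren ρ' u) ∎
    ... | is-kept z = begin
      ne (bv (ρ' z)) (renSp ρ' (subSp d sp u))  ≡⟨ cong (ne (bv (ρ' z))) (renSp-subSp c sp u) ⟩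
      ne (bv (ρ' z)) (subSp d' (renSp ρ sp) (ren ρ' u))
        ≡⟨ sym (sub-keptVar d' (ρ' z) (renSp ρ sp) (ren ρ' u)) ⟩
      sub d' (ne (bv (keptVar d' (ρ' z))) (renSp ρ sp)) (ren ρ' u)
        ≡⟨ cong (λ y → sub d' (ne (bv y) (renSp ρ sp)) (ren ρ' u)) (sym (RenDel.ren-kept c z)) ⟩
      sub d' (ne (bv (ρ (keptVar d z))) (renSp ρ sp)) (ren ρ' u) ∎
    ren-sub c (ne (fv A n) sp) u = cong (ne (fv A n)) (renSp-subSp c sp u)
    ren-sub c (ne (fs f) sp)   u = cong (ne (fs f)) (renSp-subSp c sp u)

    renSp-subSp : {ρ : Ren Γ Δ} {ρ' : Ren Γ' Δ'} {d : Del A Γ Γ'} {d' : Del A Δ Δ'} →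
                  RenDel ρ ρ' d d' → (sp : Sp Γ C b) (u : Nf Γ' A) →
                  renSp ρ' (subSp d sp u) ≡ subSp d' (renSp ρ sp) (ren ρ' u)
    renSp-subSp c []       u = refl
    renSp-subSp c (t ∷ sp) u = cong₂ _∷_ (ren-sub c t u) (renSp-subSp c sp u)

    ren-apply : (ρ : Ren Γ Δ) (t : Nf Γ C) (sp : Sp Γ C b) →
                ren ρ (apply t sp) ≡ apply (ren ρ t) (renSp ρ sp)
    ren-apply ρ t       []       = refl
    ren-apply ρ (lam t) (e ∷ sp) =
      trans (ren-apply ρ (sub dhere t e) sp)
            (cong (λ s → apply s (renSp ρ sp)) (ren-sub (renDel-here ρ) t e))

  AvoidsDel : (ρ : Ren Θ Γ) (ρ' : Ren Θ Γ') (d : Del A Γ Γ') → Set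
  AvoidsDel {Θ = Θ} ρ ρ' d = ∀ {C} (y : C ∈ Θ) → ρ y ≡ keptVar d (ρ' y)

  avoidsDel-lift : {ρ : Ren Θ Γ} {ρ' : Ren Θ Γ'} {d : Del A Γ Γ'} →
                   AvoidsDel ρ ρ' d → AvoidsDel (liftR {C = E} ρ) (liftR ρ') (dthere d)
  avoidsDel-lift c here      = refl
  avoidsDel-lift c (there y) = cong there (c y)

  mutual
    sub-ren-avoiding : {ρ : Ren Θ Γ} {ρ' : Ren Θ Γ'} {d : Del A Γ Γ'} → AvoidsDel ρ ρ' d →
                       (t : Nf Θ C) (u : Nf Γ' A) → sub d (ren ρ t) u ≡ ren ρ' t
    sub-ren-avoiding c (lam t) u = cong lam (sub-ren-avoiding (avoidsDel-lift c) t (wk u))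
    sub-ren-avoiding {ρ = ρ} {ρ'} {d} c (ne (bv y) sp) u = begin
      sub d (ne (bv (ρ y)) (renSp ρ sp)) u
        ≡⟨ cong (λ z → sub d (ne (bv z) (renSp ρ sp)) u) (c y) ⟩
      sub d (ne (bv (keptVar d (ρ' y))) (renSp ρ sp)) u ≡⟨ sub-keptVar d (ρ' y) (renSp ρ sp) u ⟩
      ne (bv (ρ' y)) (subSp d (renSp ρ sp) u)            ≡⟨ cong (ne (bv (ρ' y))) (subSp-renSp-avoiding c sp u) ⟩
      ne (bv (ρ' y)) (renSp ρ' sp)                       ∎
    sub-ren-avoiding c (ne (fv A n) sp) u = cong (ne (fv A n)) (subSp-renSp-avoiding c sp u)
    sub-ren-avoiding c (ne (fs f) sp)   u = cong (ne (fs f)) (subSp-renSp-avoiding c sp u)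

    subSp-renSp-avoiding : {ρ : Ren Θ Γ} {ρ' : Ren Θ Γ'} {d : Del A Γ Γ'} → AvoidsDel ρ ρ' d →
                           (sp : Sp Θ C b) (u : Nf Γ' A) → subSp d (renSp ρ sp) u ≡ renSp ρ' sp
    subSp-renSp-avoiding c []       u = refl
    subSp-renSp-avoiding c (t ∷ sp) u = cong₂ _∷_ (sub-ren-avoiding c t u) (subSp-renSp-avoiding c sp u)

  sub-keptVar-ren : (d : Del A Γ Γ') (u : Nf Γ' C) (v : Nf Γ' A) → sub d (ren (keptVar d) u) v ≡ u
  sub-keptVar-ren d u v = trans (sub-ren-avoiding {ρ' = λ y → y} (λ y → refl) u v) (ren-id u)

  sub-wk0 : (d : Del A Γ Γ') (w : Tm C) (v : Nf Γ' A) → sub d (wk0 w) v ≡ wk0 w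
  sub-wk0 d w v = trans (sub-ren-avoiding {ρ' = λ ()} (λ ()) w v) (ren-cong (λ ()) w)

  -- The substitution lemma

  variable
    d₁ d₁' : Del A Γ Γ'
    d₂ d₂' : Del D Γ Γ'

  -- Removing first the variable of d₁ and then that of d₂ is the same as
  -- removing first that of d₂' and then that of d₁'.
  data Swap {A D : Ty B} : ∀ {Γ Γ₁ Γ₁₂ Γ₂} →
         Del A Γ Γ₁ → Del D Γ₁ Γ₁₂ → Del D Γ Γ₂ → Del A Γ₂ Γ₁₂ → Set where
    swap-here  : (d : Del D Γ Δ) → Swap dhere d (dthere d) dhere
    swap-there : ∀ {Γ Γ₁ Γ₁₂ Γ₂} {d₁ : Del A Γ Γ₁} {d₂ : Del D Γ₁ Γ₁₂} {d₂' : Del D Γ Γ₂}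
                   {d₁' : Del A Γ₂ Γ₁₂} →
                 Swap d₁ d₂ d₂' d₁' → Swap (dthere {C = E} d₁) (dthere d₂) (dthere d₂') (dthere d₁')

  data Compare₂ {Γ Γ₁ Γ₁₂ Γ₂} {d₁ : Del A Γ Γ₁} {d₂ : Del D Γ₁ Γ₁₂} {d₂' : Del D Γ Γ₂}
                {d₁' : Del A Γ₂ Γ₁₂} (sw : Swap d₁ d₂ d₂' d₁') : C ∈ Γ → Set where
    first-deleted  : Compare₂ sw (deletedVar d₁)
    second-deleted : Compare₂ sw (keptVar d₁ (deletedVar d₂))
    both-kept      : (z : C ∈ Γ₁₂) → Compare₂ sw (keptVar d₁ (keptVar d₂ z))

  swap-first : Swap d₁ d₂ d₂' d₁' → deletedVar d₁ ≡ keptVar d₂' (deletedVar d₁')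
  swap-first (swap-here d)   = refl
  swap-first (swap-there sw) = cong there (swap-first sw)

  swap-second : Swap d₁ d₂ d₂' d₁' → keptVar d₁ (deletedVar d₂) ≡ deletedVar d₂'
  swap-second (swap-here d)   = refl
  swap-second (swap-there sw) = cong there (swap-second sw)

  swap-kept : Swap {Γ₁₂ = Γ₁₂} d₁ d₂ d₂' d₁' → (z : C ∈ Γ₁₂) →
              keptVar d₁ (keptVar d₂ z) ≡ keptVar d₂' (keptVar d₁' z)
  swap-kept (swap-here d)   z         = refl
  swap-kept (swap-there sw) here      = refl
  swap-kept (swap-there sw) (there z) = cong there (swap-kept sw z)

  compare₂-here : (d : Del D Γ Δ) {y : C ∈ Γ} → Compare d y →
                  Compare₂ (swap-here {A = A} d) (there y)
  compare₂-here d is-deleted  = second-deleted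
  compare₂-here d (is-kept z) = both-kept z

  compare₂-there : {sw : Swap d₁ d₂ d₂' d₁'} {y : C ∈ Γ} →
                   Compare₂ sw y → Compare₂ (swap-there {E = E} sw) (there y)
  compare₂-there first-deleted  = first-deleted
  compare₂-there second-deleted = second-deleted
  compare₂-there (both-kept z)  = both-kept (there z)

  compare₂ : (sw : Swap d₁ d₂ d₂' d₁') (y : C ∈ Γ) → Compare₂ sw y
  compare₂ (swap-here d)   here      = first-deleted
  compare₂ (swap-here d)   (there y) = compare₂-here d (compare d y)
  compare₂ (swap-there sw) here      = both-kept here
  compare₂ (swap-there sw) (there y) = compare₂-there (compare₂ sw y)

  mutual
    sub-sub : (sw : Swap {Γ₁ = Γ₁} {Γ₁₂} d₁ d₂ d₂' d₁') (t : Nf Γ C) (e : Nf Γ₁ A) (u : Nf Γ₁₂ D) →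
              sub d₂ (sub d₁ t e) u ≡ sub d₁' (sub d₂' t (ren (keptVar d₁') u)) (sub d₂ e u)
    sub-sub {d₂ = d₂} {d₂' = d₂'} {d₁' = d₁'} sw (lam t) e u =
      cong lam (trans (sub-sub (swap-there sw) t (wk e) (wk u))
        (cong₂ (λ a c → sub (dthere d₁') (sub (dthere d₂') t a) c)
               (ren-wk (keptVar (dthere d₁')) (keptVar d₁') (λ y → refl) u)
               (sym (ren-sub (renDel-wk d₂) e u))))
    sub-sub {d₁ = d₁} {d₂ = d₂} {d₂' = d₂'} {d₁' = d₁'} sw (ne (bv y) sp) e u with compare₂ sw y
    ... | first-deleted = begin
      sub d₂ (sub d₁ (ne (bv (deletedVar d₁)) sp) e) u
        ≡⟨ cong (λ w → sub d₂ w u) (sub-deletedVar d₁ sp e) ⟩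
      sub d₂ (apply e (subSp d₁ sp e)) u     ≡⟨ sub-apply d₂ e (subSp d₁ sp e) u ⟩
      apply v (subSp d₂ (subSp d₁ sp e) u)   ≡⟨ cong (apply v) (subSp-subSp sw sp e u) ⟩
      apply v (subSp d₁' (subSp d₂' sp u') v) ≡⟨ sym (sub-deletedVar d₁' (subSp d₂' sp u') v) ⟩
      sub d₁' (ne (bv (deletedVar d₁')) (subSp d₂' sp u')) v
        ≡⟨ cong (λ w → sub d₁' w v) (sym (sub-keptVar d₂' (deletedVar d₁') sp u')) ⟩
      sub d₁' (sub d₂' (ne (bv (keptVar d₂' (deletedVar d₁'))) sp) u') v
        ≡⟨ cong (λ y → sub d₁' (sub d₂' (ne (bv y) sp) u') v) (sym (swap-first sw)) ⟩
      sub d₁' (sub d₂' (ne (bv (deletedVar d₁)) sp) u') v ∎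
      where u' = ren (keptVar d₁') u
            v  = sub d₂ e u
    ... | second-deleted = begin
      sub d₂ (sub d₁ (ne (bv (keptVar d₁ (deletedVar d₂))) sp) e) u
        ≡⟨ cong (λ w → sub d₂ w u) (sub-keptVar d₁ (deletedVar d₂) sp e) ⟩
      sub d₂ (ne (bv (deletedVar d₂)) (subSp d₁ sp e)) u ≡⟨ sub-deletedVar d₂ (subSp d₁ sp e) u ⟩
      apply u (subSp d₂ (subSp d₁ sp e) u)   ≡⟨ cong (apply u) (subSp-subSp sw sp e u) ⟩
      apply u (subSp d₁' (subSp d₂' sp u') v)
        ≡⟨ cong (λ w → apply w (subSp d₁' (subSp d₂' sp u') v)) (sym (sub-keptVar-ren d₁' u v)) ⟩
      apply (sub d₁' u' v) (subSp d₁' (subSp d₂' sp u') v) ≡⟨ sym (sub-apply d₁' u' (subSp d₂' sp u') v) ⟩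
      sub d₁' (apply u' (subSp d₂' sp u')) v
        ≡⟨ cong (λ w → sub d₁' w v) (sym (sub-deletedVar d₂' sp u')) ⟩
      sub d₁' (sub d₂' (ne (bv (deletedVar d₂')) sp) u') v
        ≡⟨ cong (λ y → sub d₁' (sub d₂' (ne (bv y) sp) u') v) (sym (swap-second sw)) ⟩
      sub d₁' (sub d₂' (ne (bv (keptVar d₁ (deletedVar d₂))) sp) u') v ∎
      where u' = ren (keptVar d₁') u
            v  = sub d₂ e u
    ... | both-kept z = begin
      sub d₂ (sub d₁ (ne (bv (keptVar d₁ (keptVar d₂ z))) sp) e) u
        ≡⟨ cong (λ w → sub d₂ w u) (sub-keptVar d₁ (keptVar d₂ z) sp e) ⟩
      sub d₂ (ne (bv (keptVar d₂ z)) (subSp d₁ sp e)) u ≡⟨ sub-keptVar d₂ z (subSp d₁ sp e) u ⟩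
      ne (bv z) (subSp d₂ (subSp d₁ sp e) u)  ≡⟨ cong (ne (bv z)) (subSp-subSp sw sp e u) ⟩
      ne (bv z) (subSp d₁' (subSp d₂' sp u') v) ≡⟨ sym (sub-keptVar d₁' z (subSp d₂' sp u') v) ⟩
      sub d₁' (ne (bv (keptVar d₁' z)) (subSp d₂' sp u')) v
        ≡⟨ cong (λ w → sub d₁' w v) (sym (sub-keptVar d₂' (keptVar d₁' z) sp u')) ⟩
      sub d₁' (sub d₂' (ne (bv (keptVar d₂' (keptVar d₁' z))) sp) u') v
        ≡⟨ cong (λ y → sub d₁' (sub d₂' (ne (bv y) sp) u') v) (sym (swap-kept sw z)) ⟩
      sub d₁' (sub d₂' (ne (bv (keptVar d₁ (keptVar d₂ z))) sp) u') v ∎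
      where u' = ren (keptVar d₁') u
            v  = sub d₂ e u
    sub-sub sw (ne (fv A n) sp) e u = cong (ne (fv A n)) (subSp-subSp sw sp e u)
    sub-sub sw (ne (fs f) sp)   e u = cong (ne (fs f)) (subSp-subSp sw sp e u)

    subSp-subSp : (sw : Swap {Γ₁ = Γ₁} {Γ₁₂} d₁ d₂ d₂' d₁') (sp : Sp Γ C b) (e : Nf Γ₁ A) (u : Nf Γ₁₂ D) →
                  subSp d₂ (subSp d₁ sp e) u ≡ subSp d₁' (subSp d₂' sp (ren (keptVar d₁') u)) (sub d₂ e u)
    subSp-subSp sw []       e u = refl
    subSp-subSp sw (t ∷ sp) e u = cong₂ _∷_ (sub-sub sw t e u) (subSp-subSp sw sp e u)

    sub-apply : (d : Del D Γ Γ') (t : Nf Γ C) (sp : Sp Γ C b) (u : Nf Γ' D) →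
                sub d (apply t sp) u ≡ apply (sub d t u) (subSp d sp u)
    sub-apply d t       []       u = refl
    sub-apply d (lam t) (e ∷ sp) u =
      trans (sub-apply d (sub dhere t e) sp u)
            (cong (λ s → apply s (subSp d sp u)) (sub-sub (swap-here d) t e u))

  -- Closing substitutions

  data PSub : Ctx → Ctx → Set where
    ε    : PSub [] []
    keep : PSub Γ Δ → PSub (A ∷ Γ) (A ∷ Δ)
    put  : Tm A → PSub Γ Δ → PSub (A ∷ Γ) Δ

  Image : Ctx → Ty B → Set
  Image Δ C = (C ∈ Δ) ⊎ Tm C

  shift : Image Δ C → Image (E ∷ Δ) C
  shift (inj₁ z) = inj₁ (there z)
  shift (inj₂ w) = inj₂ w

  lookup : PSub Γ Δ → C ∈ Γ → Image Δ C
  lookup (keep σ)  here      = inj₁ here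
  lookup (keep σ)  (there y) = shift (lookup σ y)
  lookup (put w σ) here      = inj₂ w
  lookup (put w σ) (there y) = lookup σ y

  applyImage : Image Δ C → Sp Δ C b → Nf Δ (base b)
  applyImage (inj₁ z) sp = ne (bv z) sp
  applyImage (inj₂ w) sp = apply (wk0 w) sp

  mutual
    psub : PSub Γ Δ → Nf Γ C → Nf Δ C
    psub σ (lam t)          = lam (psub (keep σ) t)
    psub σ (ne (bv y) sp)   = applyImage (lookup σ y) (psubSp σ sp)
    psub σ (ne (fv A n) sp) = ne (fv A n) (psubSp σ sp)
    psub σ (ne (fs f) sp)   = ne (fs f) (psubSp σ sp)

    psubSp : PSub Γ Δ → Sp Γ C b → Sp Δ C b
    psubSp σ []       = []
    psubSp σ (t ∷ sp) = psub σ t ∷ psubSp σ sp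

  assign : PSub Γ Δ → Del A Δ Δ' → Tm A → PSub Γ Δ'
  assign (keep σ)  dhere      v = put v σ
  assign (keep σ)  (dthere d) v = keep (assign σ d v)
  assign (put w σ) d          v = put w (assign σ d v)

  data Assigned (d : Del A Δ Δ') (v : Tm A) : Image Δ C → Image Δ' C → Set where
    assigned   : Assigned d v (inj₁ (deletedVar d)) (inj₂ v)
    still-kept : (z : C ∈ Δ') → Assigned d v (inj₁ (keptVar d z)) (inj₁ z)
    replaced   : (w : Tm C) → Assigned d v (inj₂ w) (inj₂ w)

  assigned-here : {v : Tm A} (a : Image Δ C) → Assigned (dhere {Γ = Δ}) v (shift a) a
  assigned-here (inj₁ z) = still-kept z
  assigned-here (inj₂ w) = replaced w

  assigned-there : {d : Del A Δ Δ'} {v : Tm A} {a : Image Δ C} {a' : Image Δ' C} →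
                   Assigned d v a a' → Assigned (dthere {C = E} d) v (shift a) (shift a')
  assigned-there assigned       = assigned
  assigned-there (still-kept z) = still-kept (there z)
  assigned-there (replaced w)   = replaced w

  lookup-assign : (σ : PSub Γ Δ) (d : Del A Δ Δ') (v : Tm A) (y : C ∈ Γ) →
                  Assigned d v (lookup σ y) (lookup (assign σ d v) y)
  lookup-assign (keep σ)  dhere      v here      = assigned
  lookup-assign (keep σ)  dhere      v (there y) = assigned-here (lookup σ y)
  lookup-assign (keep σ)  (dthere d) v here      = still-kept here
  lookup-assign (keep σ)  (dthere d) v (there y) = assigned-there (lookup-assign σ d v y)
  lookup-assign (put w σ) d          v here      = replaced w
  lookup-assign (put w σ) d          v (there y) = lookup-assign σ d v y

  sub-applyImage : (d : Del A Δ Δ') (v : Tm A) {a : Image Δ C} {a' : Image Δ' C} →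
                   Assigned d v a a' → (sp : Sp Δ C b) →
                   sub d (applyImage a sp) (wk0 v) ≡ applyImage a' (subSp d sp (wk0 v))
  sub-applyImage d v assigned       sp = sub-deletedVar d sp (wk0 v)
  sub-applyImage d v (still-kept z) sp = sub-keptVar d z sp (wk0 v)
  sub-applyImage d v (replaced w)   sp =
    trans (sub-apply d (wk0 w) sp (wk0 v))
          (cong (λ s → apply s (subSp d sp (wk0 v))) (sub-wk0 d w (wk0 v)))

  mutual
    sub-psub : (σ : PSub Γ Δ) (d : Del A Δ Δ') (v : Tm A) (t : Nf Γ C) →
               sub d (psub σ t) (wk0 v) ≡ psub (assign σ d v) t
    sub-psub σ d v (lam t) =
      cong lam (trans (cong (sub (dthere d) (psub (keep σ) t)) (wk-wk0 v))
                      (sub-psub (keep σ) (dthere d) v t))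
    sub-psub σ d v (ne (bv y) sp) =
      trans (sub-applyImage d v (lookup-assign σ d v y) (psubSp σ sp))
            (cong (applyImage (lookup (assign σ d v) y)) (subSp-psubSp σ d v sp))
    sub-psub σ d v (ne (fv A n) sp) = cong (ne (fv A n)) (subSp-psubSp σ d v sp)
    sub-psub σ d v (ne (fs f) sp)   = cong (ne (fs f)) (subSp-psubSp σ d v sp)

    subSp-psubSp : (σ : PSub Γ Δ) (d : Del A Δ Δ') (v : Tm A) (sp : Sp Γ C b) →
                   subSp d (psubSp σ sp) (wk0 v) ≡ psubSp (assign σ d v) sp
    subSp-psubSp σ d v []       = refl
    subSp-psubSp σ d v (t ∷ sp) = cong₂ _∷_ (sub-psub σ d v t) (subSp-psubSp σ d v sp)

  napp-psub : (σ : PSub Γ []) (t : Nf (A ∷ Γ) C) (v : Tm A) →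
              napp (psub σ (lam t)) v ≡ psub (put v σ) t
  napp-psub σ t v = begin
    substNf (psub (keep σ) t) here v       ≡⟨ substNf≡sub (psub (keep σ) t) here v ⟩
    sub dhere (psub (keep σ) t) v          ≡⟨ cong (sub dhere (psub (keep σ) t)) (sym (wk0-closed v)) ⟩
    sub dhere (psub (keep σ) t) (wk0 v)    ≡⟨ sub-psub (keep σ) dhere v t ⟩
    psub (put v σ) t                       ∎

  idPSub : (Γ : Ctx) → PSub Γ Γ
  idPSub []      = ε
  idPSub (A ∷ Γ) = keep (idPSub Γ)

  lookup-idPSub : (y : C ∈ Γ) → lookup (idPSub Γ) y ≡ inj₁ y
  lookup-idPSub here = refl
  lookup-idPSub (there y) rewrite lookup-idPSub y = refl

  mutual
    psub-id : (t : Nf Γ C) → psub (idPSub Γ) t ≡ t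
    psub-id (lam t) = cong lam (psub-id t)
    psub-id (ne (bv y) sp) rewrite lookup-idPSub y = cong (ne (bv y)) (psubSp-id sp)
    psub-id (ne (fv A n) sp) = cong (ne (fv A n)) (psubSp-id sp)
    psub-id (ne (fs f) sp)   = cong (ne (fs f)) (psubSp-id sp)

    psubSp-id : (sp : Sp Γ C b) → psubSp (idPSub Γ) sp ≡ sp
    psubSp-id []       = refl
    psubSp-id (t ∷ sp) = cong₂ _∷_ (psub-id t) (psubSp-id sp)

  -- Strong computability

  module _ (R : HRSys) where

    SN-appSp : (w : Tm C) → SC R C w → (sp : Sp [] C b) → AllSpSC R sp → SN R (appSp w sp)
    SN-appSp w       sc []       _          = sc
    SN-appSp (lam t) sc (u ∷ sp) (scu , sc*) = SN-appSp (substNf t here u) (sc u scu) sp sc*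

    SCPSub : PSub Γ Δ → Set
    SCPSub ε         = ⊤
    SCPSub (keep σ)  = SCPSub σ
    SCPSub (put w σ) = SC R _ w × SCPSub σ

    SCImage : Image Δ C → Set
    SCImage (inj₁ _) = ⊤
    SCImage (inj₂ w) = SC R _ w

    SCImage-shift : (a : Image Δ C) → SCImage a → SCImage (shift {E = E} a)
    SCImage-shift (inj₁ z) _  = tt
    SCImage-shift (inj₂ w) sc = sc

    SCImage-lookup : (σ : PSub Γ Δ) → SCPSub σ → (y : C ∈ Γ) → SCImage (lookup σ y)
    SCImage-lookup (keep σ)  scσ here      = tt
    SCImage-lookup (keep σ)  scσ (there y) = SCImage-shift (lookup σ y) (SCImage-lookup σ scσ y)
    SCImage-lookup (put w σ) scσ here      = proj₁ scσ
    SCImage-lookup (put w σ) scσ (there y) = SCImage-lookup σ (proj₂ scσ) y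

    SN-applyImage : (a : Image [] C) → SCImage a → (sp : Sp [] C b) → AllSpSC R sp →
                    SN R (applyImage a sp)
    SN-applyImage (inj₂ w) sc sp sc* =
      subst (SN R) (trans (appSp≡apply w sp) (cong (λ s → apply s sp) (sym (wk0-closed w))))
            (SN-appSp w sc sp sc*)

    module _ (args-SC⇒SC : ∀ (b : B) (t : Tm (base b)) → ¬ ((¬ SC R (base b) t) × ArgsSC R t)) where

      SN-ne : ∀ {A} (h : Head [] A) (sp : Sp [] A b) → AllSpSC R sp → SN R (ne h sp)
      SN-ne h sp sc* inf = args-SC⇒SC _ (ne h sp) ((λ sn → sn inf) , sc*)

      mutual
        SC-psub : (σ : PSub Γ []) → SCPSub σ → (t : Nf Γ C) → SC R C (psub σ t)
        SC-psub σ scσ (lam t) v scv =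
          subst (SC R _) (sym (napp-psub σ t v)) (SC-psub (put v σ) (scv , scσ) t)
        SC-psub σ scσ (ne (bv y) sp) =
          SN-applyImage (lookup σ y) (SCImage-lookup σ scσ y) (psubSp σ sp) (AllSpSC-psubSp σ scσ sp)
        SC-psub σ scσ (ne (fv A n) sp) = SN-ne (fv A n) (psubSp σ sp) (AllSpSC-psubSp σ scσ sp)
        SC-psub σ scσ (ne (fs f) sp)   = SN-ne (fs f) (psubSp σ sp) (AllSpSC-psubSp σ scσ sp)

        AllSpSC-psubSp : (σ : PSub Γ []) → SCPSub σ → (sp : Sp Γ C b) → AllSpSC R (psubSp σ sp)
        AllSpSC-psubSp σ scσ []       = tt
        AllSpSC-psubSp σ scσ (t ∷ sp) = SC-psub σ scσ t , AllSpSC-psubSp σ scσ sp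

      SC-all : (t : Tm C) → SC R C t
      SC-all t = subst (SC R _) (psub-id t) (SC-psub ε tt t)

  target : Ty B → B
  target (base b) = b
  target (A ⇒ C)  = target C

  -- target A is only needed as some basic type, so that x(t) is well-typed.
  applyFreeVar : Tm A → Tm (base (target A))
  applyFreeVar {A} t = ne (fv (A ⇒ base (target A)) 0) (t ∷ [])

  infSeq-applyFreeVar : (R : HRSys) (t : Tm A) → InfSeqFrom R t → InfSeqFrom R (applyFreeVar t)
  infSeq-applyFreeVar R t (f , f0≡t , steps) =
    (λ i → applyFreeVar (f i)) , cong applyFreeVar f0≡t , (λ i → argS (hereS (steps i)))

lemma3 : (B F : Set) (tyF : F → Ty B) (R : HRS.HRSys B F tyF) →
           let open HRS B F tyF in
           NonTerminating R →
           ¬ (∀ (b : B) (t : Tm (base b)) → ¬ ((¬ SC R (base b) t) × ArgsSC R t))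
lemma3 B F tyF R nonTerminating args-SC⇒SC = nonTerminating λ { (A , t , inf) →
  args-SC⇒SC (target A) (applyFreeVar t)
    ((λ sn → sn (infSeq-applyFreeVar R t inf)) , SC-all R args-SC⇒SC t , tt) }
  where open Metatheory B F tyF
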